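{- Let $m,s\in\mathbb{Z}_2$ and $k\in\mathbb{Z}_2^\times$ with $k\ne\pm1$, and put $\ell=\frac{k-1}{2}$. Assume $v_2(\ell)\ge1$. (1) If $v_2(m)=v_2(s)\le v_2(\ell)$, then $\gamma^m z_k$ and $\gamma^s z_k$ are conjugate in $\Omega$. (2) If $v_2(m)\le v_2(\ell)$, then $\gamma^m z_k$ is strongly settled; moreover every vertex at every level $n\ge v_2(m)$ lies in a stable cycle of $\gamma^m z_k$, i.e. $s_n(\gamma^m z_k)=2^n$.
   Context: $T$ is the rooted binary tree of finite words over $X=\{0,1\}$, $\Omega=\mathrm{Aut}(T)$ acting on the right. Each $\alpha\in\Omega$ is uniquely $(\alpha_0,\alpha_1)\tau$, $\tau\in\{\mathrm{id},\sigma\}$, meaning $(xv)\alpha=(x)\tau\,(v)\alpha_x$. $\alpha^m$ for $m\in\mathbb{Z}_2$ is the $2$-adic limit of integer powers. Standard odometer $\gamma=(\gamma,\mathrm{id})\sigma$; for $k\in\mathbb{Z}_2^\times$ with $\ell=(k-1)/2$, $z_k=(z_k,\gamma^\ell z_k)$ recursively. $v_2$ is the $2$-adic valuation. A vertex $v$ at level $n$ lies in a stable cycle of $\alpha$ of length $k'$ if its $\alpha$-orbit has $k'$ elements and for every $m'>n$ the vertices at level $m'$ above this orbit form one $\alpha$-cycle of length $2^{m'-n}k'$; $s_n(\alpha)$ counts such vertices at level $n$. $\alpha$ is strongly settled if for some $n$ every vertex at level $n$ lies in a stable cycle. -}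

module Defs where

open import Data.Bool using (Bool; true; false; _xor_; not)
open import Data.Nat using (ℕ; zero; suc; _+_; _*_; _^_; _<_; _≤_)
open import Data.List using (List; []; _∷_; length; _++_)
open import Data.Product using (Σ; _×_; _,_; ∃)
open import Relation.Binary.PropositionalEquality using (_≡_; _≢_)
open import Relation.Nullary using (¬_)

-- Vertices of T: finite words over X = {0,1} (false = 0, true = 1).
Word : Set
Word = List Bool

-- An automorphism is encoded by its portrait: for each vertex w, whether
-- the label τ of the section at w is σ (true) or id (false).
-- This is a bijective encoding of Aut(T):  α = (α_0 , α_1) τ  with
-- τ = α [] and α_x = λ w → α (x ∷ w).
Aut : Set
Aut = Word → Bool

root : Aut → Bool
root α = α []

section : Aut → Bool → Aut
section α x w = α (x ∷ w)

node : Aut → Aut → Bool → Aut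
node a₀ a₁ τ []            = τ
node a₀ a₁ τ (false ∷ w)   = a₀ w
node a₀ a₁ τ (true  ∷ w)   = a₁ w

-- right action:  (x v) α = (x)τ (v) α_x
act : Aut → Word → Word
act α []      = []
act α (x ∷ v) = (x xor α []) ∷ act (section α x) v

_≈_ : Aut → Aut → Set
α ≈ β = ∀ v → act α v ≡ act β v

idA : Aut
idA _ = false

-- product αβ (right action: first α, then β), i.e. (v)(αβ) = ((v)α)β
_∙_ : Aut → Aut → Aut
(α ∙ β) []      = α [] xor β []
(α ∙ β) (x ∷ w) = (section α x ∙ section β (x xor α [])) w

infixl 7 _∙_

pow : Aut → ℕ → Aut
pow α zero    = idA
pow α (suc n) = pow α n ∙ α

-- 2-adic integers, as digit sequences (least significant digit first)

ℤ₂ : Set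
ℤ₂ = ℕ → Bool

bit : Bool → ℕ
bit true  = 1
bit false = 0

trunc : ℤ₂ → ℕ → ℕ
trunc m zero    = 0
trunc m (suc d) = trunc m d + bit (m d) * 2 ^ d

-- 2-adic powers α^m: the 2-adic limit of integer powers.
-- The label of α^m at a vertex w only depends on the action on level
-- |w|+1, where Aut(T_{|w|+1}) has order 2^(2^(|w|+1) - 1); hence the
-- integer powers α^(m mod 2^d) stabilise there once d ≥ 2^(|w|+1).
_^₂_ : Aut → ℤ₂ → Aut
(α ^₂ m) w = pow α (trunc m (2 ^ (2 ^ suc (length w)))) w

one₂ : ℤ₂
one₂ zero    = true
one₂ (suc _) = false

minusOne₂ : ℤ₂
minusOne₂ _ = true

_≡₂_ : ℤ₂ → ℤ₂ → Set
a ≡₂ b = ∀ i → a i ≡ b i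

IsUnit₂ : ℤ₂ → Set
IsUnit₂ k = k 0 ≡ true

-- ℓ = (k - 1)/2 for a unit k: subtracting 1 clears digit 0, halving shifts.
ell : ℤ₂ → ℤ₂
ell k i = k (suc i)

HasVal : ℤ₂ → ℕ → Set
HasVal x a = x a ≡ true × (∀ j → j < a → x j ≡ false)

-- a ≤ v₂(x)   (includes the case v₂(x) = ∞, i.e. x = 0)
ValAtLeast : ℤ₂ → ℕ → Set
ValAtLeast x a = ∀ j → j < a → x j ≡ false

-- γ = (γ , id) σ
γ : Aut
γ []          = true
γ (false ∷ w) = γ w
γ (true  ∷ w) = false

-- z_k = (z_k , γ^ℓ z_k): the unique solution, obtained by iterating
-- z ↦ (z , γ^ℓ z) starting from id; the n-th iterate is correct on all
-- vertices of length < n.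
zIter : ℤ₂ → ℕ → Aut
zIter k zero    = idA
zIter k (suc n) = node (zIter k n) ((γ ^₂ ell k) ∙ zIter k n) false

z : ℤ₂ → Aut
z k w = zIter k (suc (length w)) w

-- α and β are conjugate in Ω: β = δ⁻¹ α δ for some δ, i.e. αδ = δβ.
Conjugate : Aut → Aut → Set
Conjugate α β = ∃ λ δ → (α ∙ δ) ≈ (δ ∙ β)

CycleLength : Aut → Word → ℕ → Set
CycleLength α v c =
  1 ≤ c × act (pow α c) v ≡ v × (∀ j → 1 ≤ j → j < c → act (pow α j) v ≢ v)

-- v lies in a stable cycle of α of length k': its orbit has k' elements
-- and for every deeper level, the vertices above the orbit of v form a
-- single α-cycle of length 2^(m'-n) k', i.e. every vertex v u above v has
-- an orbit of that size (which then exhausts all vertices above the orbit).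
InStableCycle : Aut → Word → Set
InStableCycle α v =
  ∃ λ k' → CycleLength α v k' ×
    (∀ (u : Word) → 1 ≤ length u → CycleLength α (v ++ u) (2 ^ length u * k'))

StronglySettled : Aut → Set
StronglySettled α = ∃ λ n → ∀ (v : Word) → length v ≡ n → InStableCycle α v

-- Reading a vertex of level n as a residue modulo 2ⁿ, γ^m acts as x ↦ x − m and z_k as x ↦ x/k, so
-- γ^m z_k acts on every level as the affine map x ↦ (x − m)/k. Its j-th power moves x by
-- (1 + k + ⋯ + k^(j−1))(2ℓx + m). If v₂(m) = a ≤ v₂(ℓ), the second factor is 2^a times an odd number,
-- and for k ≡ 1 (mod 4) the first has the same valuation as j; so every vertex of level a + e has an
-- orbit of length exactly 2^e, which is the stable-cycle property at all levels ≥ a. For the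
-- conjugacy, z_c z_t with c = m/2^a and t = (s/2^a)⁻¹ acts as division by m/s, and conjugating
-- x ↦ (x − s)/k by it gives x ↦ (x − m)/k.

module Submission where

open import Defs
open import Data.Bool using (Bool; true; false; _xor_)
open import Data.Bool.Properties using (xor-assoc; xor-identityʳ)
open import Data.Nat using (ℕ; zero; suc; _+_; _*_; _^_; _<_; _≤_; _∸_; z≤n; s≤s; NonZero; _%_)
open import Data.Nat.Properties
open import Data.Nat.DivMod using ([m+kn]%n≡m%n; m<n⇒m%n≡m)
open import Data.Nat.Divisibility using (_∣_; divides)
open import Data.Nat.Tactic.RingSolver using (solve)
open import Data.Product using (∃; ∃₂; _×_; _,_; proj₁; proj₂)
open import Data.Sum using (_⊎_; inj₁; inj₂)
open import Data.Empty using (⊥-elim)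
open import Data.List using ([]; _∷_; length; _++_; _∷ʳ_)
open import Data.List.Properties using (∷ʳ-injective; length-++)
open import Relation.Binary.Bundles using (Setoid)
open import Relation.Binary.PropositionalEquality
open import Relation.Nullary using (¬_)
import Relation.Binary.Reasoning.Setoid as SetoidReasoning

-- Congruences modulo q

infix 4 _≡_[mod_]

_≡_[mod_] : ℕ → ℕ → ℕ → Set
a ≡ b [mod q ] = ∃₂ λ i j → a + i * q ≡ b + j * q

module _ {q : ℕ} where
  ≡-mod-reflexive : ∀ {a b} → a ≡ b → a ≡ b [mod q ]
  ≡-mod-reflexive refl = 0 , 0 , refl

  ≡-mod-refl : ∀ {a} → a ≡ a [mod q ]
  ≡-mod-refl = ≡-mod-reflexive refl

  ≡-mod-sym : ∀ {a b} → a ≡ b [mod q ] → b ≡ a [mod q ]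
  ≡-mod-sym (i , j , e) = j , i , sym e

  ≡-mod-trans : ∀ {a b c} → a ≡ b [mod q ] → b ≡ c [mod q ] → a ≡ c [mod q ]
  ≡-mod-trans {a} {b} {c} (i , j , e) (i' , j' , e') = i + i' , j' + j , (begin
    a + (i + i') * q      ≡⟨ solve (a ∷ i ∷ i' ∷ q ∷ []) ⟩
    (a + i * q) + i' * q  ≡⟨ cong (_+ i' * q) e ⟩
    (b + j * q) + i' * q  ≡⟨ solve (b ∷ j ∷ i' ∷ q ∷ []) ⟩
    (b + i' * q) + j * q  ≡⟨ cong (_+ j * q) e' ⟩
    (c + j' * q) + j * q  ≡⟨ solve (c ∷ j' ∷ j ∷ q ∷ []) ⟩
    c + (j' + j) * q      ∎)
    where open ≡-Reasoning

  m+kq≡m-mod : ∀ a k → a + k * q ≡ a [mod q ]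
  m+kq≡m-mod a k = 0 , k , +-identityʳ _

  kq≡0-mod : ∀ k → k * q ≡ 0 [mod q ]
  kq≡0-mod = m+kq≡m-mod 0

  +-cong-mod : ∀ {a b c d} → a ≡ b [mod q ] → c ≡ d [mod q ] → a + c ≡ b + d [mod q ]
  +-cong-mod {a} {b} {c} {d} (i , j , e) (i' , j' , e') = i + i' , j + j' , (begin
    a + c + (i + i') * q        ≡⟨ solve (a ∷ c ∷ i ∷ i' ∷ q ∷ []) ⟩
    (a + i * q) + (c + i' * q)  ≡⟨ cong₂ _+_ e e' ⟩
    (b + j * q) + (d + j' * q)  ≡⟨ solve (b ∷ d ∷ j ∷ j' ∷ q ∷ []) ⟩
    b + d + (j + j') * q        ∎)
    where open ≡-Reasoning

  +-congˡ-mod : ∀ c {a b} → a ≡ b [mod q ] → c + a ≡ c + b [mod q ]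
  +-congˡ-mod c = +-cong-mod ≡-mod-refl

  +-congʳ-mod : ∀ c {a b} → a ≡ b [mod q ] → a + c ≡ b + c [mod q ]
  +-congʳ-mod c a≡b = +-cong-mod a≡b ≡-mod-refl

  *-congˡ-mod : ∀ c {a b} → a ≡ b [mod q ] → c * a ≡ c * b [mod q ]
  *-congˡ-mod c {a} {b} (i , j , e) = c * i , c * j , (begin
    c * a + c * i * q  ≡⟨ solve (c ∷ a ∷ i ∷ q ∷ []) ⟩
    c * (a + i * q)    ≡⟨ cong (c *_) e ⟩
    c * (b + j * q)    ≡⟨ solve (c ∷ b ∷ j ∷ q ∷ []) ⟩
    c * b + c * j * q  ∎)
    where open ≡-Reasoning

  *-cong-mod : ∀ {a b c d} → a ≡ b [mod q ] → c ≡ d [mod q ] → a * c ≡ b * d [mod q ]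
  *-cong-mod {a} {b} {c} {d} a≡b c≡d = ≡-mod-trans
    (≡-mod-reflexive (*-comm a c))
    (≡-mod-trans (*-congˡ-mod c a≡b)
      (≡-mod-trans (≡-mod-reflexive (*-comm c b)) (*-congˡ-mod b c≡d)))

  +-cancelʳ-mod : ∀ c {a b} → a + c ≡ b + c [mod q ] → a ≡ b [mod q ]
  +-cancelʳ-mod c {a} {b} (i , j , e) = i , j , +-cancelʳ-≡ c _ _ (begin
    a + i * q + c  ≡⟨ solve (a ∷ i ∷ q ∷ c ∷ []) ⟩
    a + c + i * q  ≡⟨ e ⟩
    b + c + j * q  ≡⟨ solve (b ∷ c ∷ j ∷ q ∷ []) ⟩
    b + j * q + c  ∎)
    where open ≡-Reasoning

  +-cancelˡ-mod : ∀ c {a b} → c + a ≡ c + b [mod q ] → a ≡ b [mod q ]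
  +-cancelˡ-mod c {a} {b} c+a≡c+b = +-cancelʳ-mod c
    (≡-mod-trans (≡-mod-reflexive (+-comm a c)) (≡-mod-trans c+a≡c+b (≡-mod-reflexive (+-comm c b))))

  ≡-mod⇒≡ : .{{_ : NonZero q}} → ∀ {a b} → a < q → b < q → a ≡ b [mod q ] → a ≡ b
  ≡-mod⇒≡ {a} {b} a<q b<q (i , j , e) = begin
    a                ≡⟨ m<n⇒m%n≡m a<q ⟨
    a % q            ≡⟨ [m+kn]%n≡m%n a i q ⟨
    (a + i * q) % q  ≡⟨ cong (_% q) e ⟩
    (b + j * q) % q  ≡⟨ [m+kn]%n≡m%n b j q ⟩
    b % q            ≡⟨ m<n⇒m%n≡m b<q ⟩
    b                ∎
    where open ≡-Reasoning

  ≡0-mod⇒≥ : ∀ {a} → a ≡ 0 [mod q ] → 0 < a → q ≤ a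
  ≡0-mod⇒≥ {a} (i , j , e) 0<a = +-cancelʳ-≤ (i * q) q a (begin
    suc i * q  ≤⟨ *-monoˡ-≤ q i<j ⟩
    j * q      ≡⟨ e ⟨
    a + i * q  ∎)
    where
    open ≤-Reasoning
    i<j : i < j
    i<j = *-cancelʳ-< q i j (begin-strict
      i * q      <⟨ m<n+m (i * q) 0<a ⟩
      a + i * q  ≡⟨ e ⟩
      j * q      ∎)

≡-mod-setoid : ℕ → Setoid _ _
≡-mod-setoid q = record
  { Carrier = ℕ
  ; _≈_ = _≡_[mod q ]
  ; isEquivalence = record { refl = ≡-mod-refl ; sym = ≡-mod-sym ; trans = ≡-mod-trans }
  }

module ≡-mod-Reasoning (q : ℕ) = SetoidReasoning (≡-mod-setoid q)

≡-mod-1 : ∀ a b → a ≡ b [mod 1 ]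
≡-mod-1 a b = b , a , (begin
  a + b * 1  ≡⟨ solve (a ∷ b ∷ []) ⟩
  b + a * 1  ∎)
  where open ≡-Reasoning

≡-mod-∣ : ∀ {p q a b} → q ∣ p → a ≡ b [mod p ] → a ≡ b [mod q ]
≡-mod-∣ {p} {q} {a} {b} (divides c refl) (i , j , e) = i * c , j * c , (begin
  a + i * c * q    ≡⟨ cong (a +_) (*-assoc i c q) ⟩
  a + i * (c * q)  ≡⟨ e ⟩
  b + j * (c * q)  ≡⟨ cong (b +_) (*-assoc j c q) ⟨
  b + j * c * q    ∎)
  where open ≡-Reasoning

*-scale-mod : ∀ c {q a b} → a ≡ b [mod q ] → c * a ≡ c * b [mod c * q ]
*-scale-mod c {q} {a} {b} (i , j , e) = i , j , (begin
  c * a + i * (c * q)  ≡⟨ solve (c ∷ a ∷ i ∷ q ∷ []) ⟩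
  c * (a + i * q)      ≡⟨ cong (c *_) e ⟩
  c * (b + j * q)      ≡⟨ solve (c ∷ b ∷ j ∷ q ∷ []) ⟩
  c * b + j * (c * q)  ∎)
  where open ≡-Reasoning

*-unscale-mod : ∀ c {q a b} .{{_ : NonZero c}} → c * a ≡ c * b [mod c * q ] → a ≡ b [mod q ]
*-unscale-mod c {q} {a} {b} (i , j , e) = i , j , *-cancelˡ-≡ _ _ c (begin
  c * (a + i * q)      ≡⟨ solve (c ∷ a ∷ i ∷ q ∷ []) ⟩
  c * a + i * (c * q)  ≡⟨ e ⟩
  c * b + j * (c * q)  ≡⟨ solve (c ∷ b ∷ j ∷ q ∷ []) ⟩
  c * (b + j * q)      ∎)
  where open ≡-Reasoning

2^-∣ : ∀ {m n} → m ≤ n → 2 ^ m ∣ 2 ^ n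
2^-∣ {m} {n} m≤n = divides (2 ^ (n ∸ m)) (begin
  2 ^ n                ≡⟨ cong (2 ^_) (m∸n+n≡m m≤n) ⟨
  2 ^ (n ∸ m + m)      ≡⟨ ^-distribˡ-+-* 2 (n ∸ m) m ⟩
  2 ^ (n ∸ m) * 2 ^ m  ∎)
  where open ≡-Reasoning

≡-mod-2^-≤ : ∀ {m n a b} → m ≤ n → a ≡ b [mod 2 ^ n ] → a ≡ b [mod 2 ^ m ]
≡-mod-2^-≤ m≤n = ≡-mod-∣ (2^-∣ m≤n)

≡-mod-2^-≡ : ∀ {m n a b} → m ≡ n → a ≡ b [mod 2 ^ m ] → a ≡ b [mod 2 ^ n ]
≡-mod-2^-≡ refl a≡b = a≡b

-- Odd numbers and their inverses modulo 2ⁿ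

Odd : ℕ → Set
Odd o = ∃ λ t → o ≡ 1 + 2 * t

odd-* : ∀ {a b} → Odd a → Odd b → Odd (a * b)
odd-* (s , refl) (t , refl) = s + t + 2 * s * t , solve (s ∷ t ∷ [])

1+2t≢2u : ∀ t u → 1 + 2 * t ≢ 2 * u
1+2t≢2u t u e = 1≢0 (begin
  1                ≡⟨ [m+kn]%n≡m%n 1 t 2 ⟨
  (1 + t * 2) % 2  ≡⟨ cong (λ x → (1 + x) % 2) (*-comm t 2) ⟩
  (1 + 2 * t) % 2  ≡⟨ cong (_% 2) e ⟩
  (2 * u) % 2      ≡⟨ cong (_% 2) (*-comm 2 u) ⟩
  (u * 2) % 2      ≡⟨ [m+kn]%n≡m%n 0 u 2 ⟩
  0                ∎)
  where
  open ≡-Reasoning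
  1≢0 : 1 ≢ 0
  1≢0 ()

parity : ∀ n → ∃ λ t → n ≡ 2 * t ⊎ n ≡ 1 + 2 * t
parity zero = 0 , inj₁ refl
parity (suc n) with parity n
... | t , inj₁ e = t , inj₂ (cong suc e)
... | t , inj₂ e = suc t , inj₁ (trans (cong suc e) (solve (t ∷ [])))

odd≡1-mod-2 : ∀ {o} → Odd o → o ≡ 1 [mod 2 ]
odd≡1-mod-2 (t , refl) = ≡-mod-trans (≡-mod-reflexive (cong (1 +_) (*-comm 2 t))) (m+kq≡m-mod 1 t)

≡0-mod-2⇒even : ∀ {x} → x ≡ 0 [mod 2 ] → ∃ λ u → x ≡ 2 * u
≡0-mod-2⇒even {x} (i , j , e) with parity x
... | t , inj₁ x≡2t = t , x≡2t
... | t , inj₂ x≡1+2t = ⊥-elim (1+2t≢2u (t + i) j (begin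
  1 + 2 * (t + i)      ≡⟨ solve (t ∷ i ∷ []) ⟩
  (1 + 2 * t) + i * 2  ≡⟨ cong (_+ i * 2) x≡1+2t ⟨
  x + i * 2            ≡⟨ e ⟩
  j * 2                ≡⟨ *-comm j 2 ⟩
  2 * j                ∎))
  where open ≡-Reasoning

odd⇒≢0-mod-2 : ∀ {x} → Odd x → ¬ (x ≡ 0 [mod 2 ])
odd⇒≢0-mod-2 (t , x≡1+2t) x≡0 with ≡0-mod-2⇒even x≡0
... | u , x≡2u = 1+2t≢2u t u (trans (sym x≡1+2t) x≡2u)

odd^2^ : ∀ {o} → Odd o → ∀ t → ∃ λ r → o ^ (2 ^ t) ≡ 1 + r * 2 ^ suc t
odd^2^ {o} (s , refl) zero = s , trans (*-identityʳ o) (solve (s ∷ []))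
odd^2^ {o} odd (suc t) with odd^2^ odd t
... | r , e = r + r * r * 2 ^ t , (begin
  o ^ (2 ^ suc t)                                 ≡⟨ cong (λ x → o ^ (2 ^ t + x)) (+-identityʳ (2 ^ t)) ⟩
  o ^ (2 ^ t + 2 ^ t)                             ≡⟨ ^-distribˡ-+-* o (2 ^ t) (2 ^ t) ⟩
  o ^ (2 ^ t) * o ^ (2 ^ t)                       ≡⟨ cong₂ _*_ e e ⟩
  (1 + r * (2 * 2 ^ t)) * (1 + r * (2 * 2 ^ t))   ≡⟨ square (2 ^ t) ⟩
  1 + (r + r * r * 2 ^ t) * (2 * (2 * 2 ^ t))     ∎)
  where
  open ≡-Reasoning
  square : ∀ P → (1 + r * (2 * P)) * (1 + r * (2 * P)) ≡ 1 + (r + r * r * P) * (2 * (2 * P))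
  square P = solve (r ∷ P ∷ [])

inverse-mod-2^ : ℕ → ℕ → ℕ
inverse-mod-2^ o n = o ^ (2 ^ n ∸ 1)

odd-inverse : ∀ {o} → Odd o → ∀ n → o * inverse-mod-2^ o n ≡ 1 [mod 2 ^ n ]
odd-inverse {o} odd n with odd^2^ odd n
... | r , e = begin
  o * o ^ (2 ^ n ∸ 1)   ≡⟨ cong (o ^_) (trans (+-comm 1 _) (m∸n+n≡m (m^n>0 2 n))) ⟩
  o ^ (2 ^ n)           ≡⟨ e ⟩
  1 + r * (2 * 2 ^ n)   ≡⟨ cong (1 +_) (*-assoc r 2 (2 ^ n)) ⟨
  1 + r * 2 * 2 ^ n     ≈⟨ m+kq≡m-mod 1 (r * 2) ⟩
  1                     ∎
  where open ≡-mod-Reasoning (2 ^ n)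

odd-*-cancelˡ-mod : ∀ {o n x y} → Odd o → o * x ≡ o * y [mod 2 ^ n ] → x ≡ y [mod 2 ^ n ]
odd-*-cancelˡ-mod {o} {n} {x} {y} odd ox≡oy = begin
  x              ≡⟨ *-identityˡ x ⟨
  1 * x          ≈⟨ *-cong-mod (odd-inverse odd n) ≡-mod-refl ⟨
  o * o⁻¹ * x    ≡⟨ reassoc x ⟩
  o⁻¹ * (o * x)  ≈⟨ *-congˡ-mod o⁻¹ ox≡oy ⟩
  o⁻¹ * (o * y)  ≡⟨ reassoc y ⟨
  o * o⁻¹ * y    ≈⟨ *-cong-mod (odd-inverse odd n) ≡-mod-refl ⟩
  1 * y          ≡⟨ *-identityˡ y ⟩
  y              ∎
  where
  open ≡-mod-Reasoning (2 ^ n)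
  o⁻¹ = inverse-mod-2^ o n
  reassoc : ∀ z → o * o⁻¹ * z ≡ o⁻¹ * (o * z)
  reassoc z = trans (cong (_* z) (*-comm o o⁻¹)) (*-assoc o⁻¹ o z)

-- Geometric sums

geometric : ℕ → ℕ → ℕ
geometric K zero    = 0
geometric K (suc j) = geometric K j + K ^ j

^≡1+*geometric : ∀ d j → suc d ^ j ≡ 1 + d * geometric (suc d) j
^≡1+*geometric d zero = cong suc (sym (*-zeroʳ d))
^≡1+*geometric d (suc j) = begin
  suc d * suc d ^ j                   ≡⟨ cong (suc d *_) (^≡1+*geometric d j) ⟩
  suc d * (1 + d * S)                 ≡⟨ expand S ⟩
  1 + d * (S + (1 + d * S))           ≡⟨ cong (λ x → 1 + d * (S + x)) (^≡1+*geometric d j) ⟨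
  1 + d * (S + suc d ^ j)             ∎
  where
  open ≡-Reasoning
  S = geometric (suc d) j
  expand : ∀ x → suc d * (1 + d * x) ≡ 1 + d * (x + (1 + d * x))
  expand x = solve (d ∷ x ∷ [])

geometric-+ : ∀ K a b → geometric K (a + b) ≡ geometric K a + K ^ a * geometric K b
geometric-+ K a zero = begin
  geometric K (a + 0)               ≡⟨ cong (geometric K) (+-identityʳ a) ⟩
  geometric K a                     ≡⟨ +-identityʳ _ ⟨
  geometric K a + 0                 ≡⟨ cong (geometric K a +_) (*-zeroʳ (K ^ a)) ⟨
  geometric K a + K ^ a * 0         ∎
  where open ≡-Reasoning
geometric-+ K a (suc b) = begin
  geometric K (a + suc b)                                ≡⟨ cong (geometric K) (+-suc a b) ⟩
  geometric K (a + b) + K ^ (a + b)                      ≡⟨ cong₂ _+_ (geometric-+ K a b) (^-distribˡ-+-* K a b) ⟩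
  geometric K a + K ^ a * geometric K b + K ^ a * K ^ b  ≡⟨ +-assoc (geometric K a) _ _ ⟩
  geometric K a + (K ^ a * geometric K b + K ^ a * K ^ b)
    ≡⟨ cong (geometric K a +_) (*-distribˡ-+ (K ^ a) (geometric K b) (K ^ b)) ⟨
  geometric K a + K ^ a * (geometric K b + K ^ b)        ∎
  where open ≡-Reasoning

geometric-2* : ∀ L i →
  geometric (1 + 2 * L) (2 * i) ≡ 2 * (geometric (1 + 2 * L) i * (1 + L * geometric (1 + 2 * L) i))
geometric-2* L i = begin
  geometric K (2 * i)                   ≡⟨ cong (geometric K) (cong (i +_) (+-identityʳ i)) ⟩
  geometric K (i + i)                   ≡⟨ geometric-+ K i i ⟩
  S + K ^ i * S                         ≡⟨ cong (λ x → S + x * S) (^≡1+*geometric (2 * L) i) ⟩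
  S + (1 + 2 * L * S) * S               ≡⟨ factor S ⟩
  2 * (S * (1 + L * S))                 ∎
  where
  open ≡-Reasoning
  K = 1 + 2 * L
  S = geometric K i
  factor : ∀ x → x + (1 + 2 * L * x) * x ≡ 2 * (x * (1 + L * x))
  factor x = solve (L ∷ x ∷ [])

2^∣geometric-2^ : ∀ L e → 2 ^ e ∣ geometric (1 + 2 * L) (2 ^ e)
2^∣geometric-2^ L zero = divides 1 refl
2^∣geometric-2^ L (suc e) with 2^∣geometric-2^ L e
... | divides c S≡c2^e = divides (c * (1 + L * S)) (begin
  geometric K (2 * 2 ^ e)               ≡⟨ geometric-2* L (2 ^ e) ⟩
  2 * (S * (1 + L * S))                 ≡⟨ cong (λ x → 2 * (x * (1 + L * S))) S≡c2^e ⟩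
  2 * (c * 2 ^ e * (1 + L * S))         ≡⟨ reassoc (2 ^ e) c (1 + L * S) ⟩
  c * (1 + L * S) * (2 * 2 ^ e)         ∎)
  where
  open ≡-Reasoning
  K = 1 + 2 * L
  S = geometric K (2 ^ e)
  reassoc : ∀ P c d → 2 * (c * P * d) ≡ c * d * (2 * P)
  reassoc P c d = solve (P ∷ c ∷ d ∷ [])

geometric≡-mod-2 : ∀ L j → geometric (1 + 2 * L) j ≡ j [mod 2 ]
geometric≡-mod-2 L zero = ≡-mod-refl
geometric≡-mod-2 L (suc j) = ≡-mod-trans
  (+-cong-mod (geometric≡-mod-2 L j) (odd≡1-mod-2 (L * geometric K j , e)))
  (≡-mod-reflexive (+-comm j 1))
  where
  K = 1 + 2 * L
  e : K ^ j ≡ 1 + 2 * (L * geometric K j)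
  e = trans (^≡1+*geometric (2 * L) j) (cong suc (*-assoc 2 L (geometric K j)))

-- One inequality of v₂(1 + K + ⋯ + K^(j−1)) = v₂(j), valid for K ≡ 1 (mod 4).
geometric≡0⇒≡0 : ∀ {L} → 2 ∣ L → ∀ e j → geometric (1 + 2 * L) j ≡ 0 [mod 2 ^ e ] → j ≡ 0 [mod 2 ^ e ]
geometric≡0⇒≡0 _ zero j _ = ≡-mod-1 j 0
geometric≡0⇒≡0 {L} 2∣L (suc e) j S≡0
  with ≡0-mod-2⇒even (≡-mod-trans (≡-mod-sym (geometric≡-mod-2 L j)) (≡-mod-2^-≤ {n = suc e} (s≤s z≤n) S≡0))
... | i , refl = *-scale-mod 2 (geometric≡0⇒≡0 2∣L e i Sᵢ≡0)
  where
  K = 1 + 2 * L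
  S = geometric K i
  1+LS-odd : Odd (1 + L * S)
  1+LS-odd = let divides h L≡h2 = 2∣L in
    h * S , trans (cong (λ x → 1 + x * S) L≡h2) (cong suc (regroup h S))
    where
    regroup : ∀ x y → x * 2 * y ≡ 2 * (x * y)
    regroup x y = solve (x ∷ y ∷ [])
  Sᵢ≡0 : S ≡ 0 [mod 2 ^ e ]
  Sᵢ≡0 = odd-*-cancelˡ-mod {n = e} 1+LS-odd (begin
    (1 + L * S) * S        ≡⟨ *-comm (1 + L * S) S ⟩
    S * (1 + L * S)        ≈⟨ *-unscale-mod 2 (≡-mod-trans (≡-mod-reflexive (sym (geometric-2* L i))) S≡0) ⟩
    0                      ≡⟨ *-zeroʳ (1 + L * S) ⟨
    (1 + L * S) * 0        ∎)
    where open ≡-mod-Reasoning (2 ^ e)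

-- Truncations of 2-adic integers

bit≤1 : ∀ b → bit b ≤ 1
bit≤1 true  = s≤s z≤n
bit≤1 false = z≤n

trunc-< : ∀ x N → trunc x N < 2 ^ N
trunc-< x zero = s≤s z≤n
trunc-< x (suc N) = begin
  suc (trunc x N + bit (x N) * 2 ^ N)  ≤⟨ +-mono-≤ (trunc-< x N) (*-monoˡ-≤ (2 ^ N) (bit≤1 (x N))) ⟩
  2 ^ N + 1 * 2 ^ N                    ≡⟨ cong (2 ^ N +_) (*-identityˡ (2 ^ N)) ⟩
  2 ^ N + 2 ^ N                        ≡⟨ cong (2 ^ N +_) (+-identityʳ (2 ^ N)) ⟨
  2 ^ suc N                            ∎
  where open ≤-Reasoning

trunc-+-≡-mod : ∀ x d r → trunc x (d + r) ≡ trunc x d [mod 2 ^ d ]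
trunc-+-≡-mod x d zero = ≡-mod-reflexive (cong (trunc x) (+-identityʳ d))
trunc-+-≡-mod x d (suc r) = begin
  trunc x (d + suc r)                             ≡⟨ cong (trunc x) (+-suc d r) ⟩
  trunc x (d + r) + b * 2 ^ (d + r)               ≡⟨ cong (λ y → trunc x (d + r) + b * y) (^-distribˡ-+-* 2 d r) ⟩
  trunc x (d + r) + b * (2 ^ d * 2 ^ r)           ≡⟨ cong (trunc x (d + r) +_) (reassoc b (2 ^ d) (2 ^ r)) ⟩
  trunc x (d + r) + b * 2 ^ r * 2 ^ d             ≈⟨ m+kq≡m-mod _ (b * 2 ^ r) ⟩
  trunc x (d + r)                                 ≈⟨ trunc-+-≡-mod x d r ⟩
  trunc x d                                       ∎
  where
  open ≡-mod-Reasoning (2 ^ d)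
  b = bit (x (d + r))
  reassoc : ∀ b P Q → b * (P * Q) ≡ b * Q * P
  reassoc b P Q = solve (b ∷ P ∷ Q ∷ [])

trunc-≡-mod : ∀ x {d D} → d ≤ D → trunc x D ≡ trunc x d [mod 2 ^ d ]
trunc-≡-mod x {d} d≤D = subst (λ D → trunc x D ≡ trunc x d [mod 2 ^ d ]) (m+[n∸m]≡n d≤D) (trunc-+-≡-mod x d _)

trunc-suc : ∀ x d → trunc x (suc d) ≡ bit (x 0) + 2 * trunc (ell x) d
trunc-suc x zero = trans (*-identityʳ (bit (x 0))) (sym (+-identityʳ (bit (x 0))))
trunc-suc x (suc d) = begin
  trunc x (suc d) + b * 2 ^ suc d                     ≡⟨ cong (_+ b * 2 ^ suc d) (trunc-suc x d) ⟩
  bit (x 0) + 2 * trunc (ell x) d + b * (2 * 2 ^ d)   ≡⟨ regroup (bit (x 0)) (trunc (ell x) d) b (2 ^ d) ⟩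
  bit (x 0) + 2 * (trunc (ell x) d + b * 2 ^ d)       ∎
  where
  open ≡-Reasoning
  b = bit (x (suc d))
  regroup : ∀ c t b P → c + 2 * t + b * (2 * P) ≡ c + 2 * (t + b * P)
  regroup c t b P = solve (c ∷ t ∷ b ∷ P ∷ [])

-- The residue modulo 2^(N+1) of the odd number 1 + 2ℓ; for a unit k it is that of k itself.
unitTrunc : ℤ₂ → ℕ → ℕ
unitTrunc k N = 1 + 2 * trunc (ell k) N

unitTrunc-odd : ∀ k N → Odd (unitTrunc k N)
unitTrunc-odd k N = trunc (ell k) N , refl

trunc-suc-unit : ∀ {k} → IsUnit₂ k → ∀ N → trunc k (suc N) ≡ unitTrunc k N
trunc-suc-unit {k} k₀≡1 N = trans (trunc-suc k N) (cong (λ b → bit b + 2 * trunc (ell k) N) k₀≡1)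

unitTrunc-≡-mod : ∀ {k} → IsUnit₂ k → ∀ {n N} → n ≤ suc N → unitTrunc k N ≡ trunc k n [mod 2 ^ n ]
unitTrunc-≡-mod {k} k₀≡1 {n} {N} n≤1+N =
  ≡-mod-trans (≡-mod-reflexive (sym (trunc-suc-unit k₀≡1 N))) (trunc-≡-mod k n≤1+N)

shift : ℕ → ℤ₂ → ℤ₂
shift a x i = x (a + i)

trunc-+-ValAtLeast : ∀ {x a} → ValAtLeast x a → ∀ d → trunc x (a + d) ≡ 2 ^ a * trunc (shift a x) d
trunc-+-ValAtLeast {x} {a} 2^a∣x zero = begin
  trunc x (a + 0)  ≡⟨ cong (trunc x) (+-identityʳ a) ⟩
  trunc x a        ≡⟨ lowDigitsZero a ≤-refl ⟩
  0                ≡⟨ *-zeroʳ (2 ^ a) ⟨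
  2 ^ a * 0        ∎
  where
  open ≡-Reasoning
  lowDigitsZero : ∀ b → b ≤ a → trunc x b ≡ 0
  lowDigitsZero zero _ = refl
  lowDigitsZero (suc b) b<a =
    cong₂ (λ t c → t + bit c * 2 ^ b) (lowDigitsZero b (<⇒≤ b<a)) (2^a∣x b b<a)
trunc-+-ValAtLeast {x} {a} 2^a∣x (suc d) = begin
  trunc x (a + suc d)                                   ≡⟨ cong (trunc x) (+-suc a d) ⟩
  trunc x (a + d) + b * 2 ^ (a + d)
    ≡⟨ cong₂ (λ t P → t + b * P) (trunc-+-ValAtLeast 2^a∣x d) (^-distribˡ-+-* 2 a d) ⟩
  2 ^ a * trunc (shift a x) d + b * (2 ^ a * 2 ^ d)     ≡⟨ factor (2 ^ a) (trunc (shift a x) d) b (2 ^ d) ⟩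
  2 ^ a * trunc (shift a x) (suc d)                     ∎
  where
  open ≡-Reasoning
  b = bit (x (a + d))
  factor : ∀ P t b Q → P * t + b * (P * Q) ≡ P * (t + b * Q)
  factor P t b Q = solve (P ∷ t ∷ b ∷ Q ∷ [])

ValAtLeast⇒2^∣trunc : ∀ {x a N} → ValAtLeast x a → a ≤ N → 2 ^ a ∣ trunc x N
ValAtLeast⇒2^∣trunc {x} {a} {N} 2^a∣x a≤N = divides (trunc (shift a x) (N ∸ a)) (begin
  trunc x N                           ≡⟨ cong (trunc x) (m+[n∸m]≡n a≤N) ⟨
  trunc x (a + (N ∸ a))               ≡⟨ trunc-+-ValAtLeast 2^a∣x (N ∸ a) ⟩
  2 ^ a * trunc (shift a x) (N ∸ a)   ≡⟨ *-comm (2 ^ a) _ ⟩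
  trunc (shift a x) (N ∸ a) * 2 ^ a   ∎)
  where open ≡-Reasoning

HasVal⇒shift-unit : ∀ {x a} → HasVal x a → IsUnit₂ (shift a x)
HasVal⇒shift-unit {x} {a} (xₐ≡1 , _) = trans (cong x (+-identityʳ a)) xₐ≡1

trunc-HasVal : ∀ {x a} → HasVal x a → ∀ e → trunc x (a + suc e) ≡ 2 ^ a * unitTrunc (shift a x) e
trunc-HasVal {x} {a} v₂x≡a e =
  trans (trunc-+-ValAtLeast (proj₂ v₂x≡a) (suc e)) (cong (2 ^ a *_) (trunc-suc-unit (HasVal⇒shift-unit v₂x≡a) e))

halve : ℕ → Bool × ℕ
halve y with parity y
... | t , inj₁ _ = false , t
... | t , inj₂ _ = true , t

halve-correct : ∀ y → y ≡ bit (proj₁ (halve y)) + 2 * proj₂ (halve y)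
halve-correct y with parity y
... | t , inj₁ e = e
... | t , inj₂ e = e

digits : ℕ → ℤ₂
digits y zero    = proj₁ (halve y)
digits y (suc i) = digits (proj₂ (halve y)) i

trunc-digits : ∀ n y → trunc (digits y) n ≡ y [mod 2 ^ n ]
trunc-digits zero y = ≡-mod-1 _ y
trunc-digits (suc n) y = begin
  trunc (digits y) (suc n)               ≡⟨ trunc-suc (digits y) n ⟩
  bit b + 2 * trunc (digits y′) n        ≈⟨ +-congˡ-mod (bit b) (*-scale-mod 2 (trunc-digits n y′)) ⟩
  bit b + 2 * y′                         ≡⟨ halve-correct y ⟨
  y                                      ∎
  where
  open ≡-mod-Reasoning (2 ^ suc n)
  b = proj₁ (halve y)
  y′ = proj₂ (halve y)

fromResidues : (f : ℕ → ℕ) → (∀ N → f (suc N) ≡ f N [mod 2 ^ N ]) →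
               ∃ λ x → ∀ N → trunc x N ≡ f N [mod 2 ^ N ]
fromResidues f compatible = x , trunc-x
  where
  x : ℤ₂
  x i = digits (f (suc i)) i
  trunc-x : ∀ N → trunc x N ≡ f N [mod 2 ^ N ]
  trunc-x zero = ≡-mod-1 _ _
  trunc-x (suc N) = ≡-mod-trans (≡-mod-reflexive (cong (_+ bit (x N) * 2 ^ N) low)) (trunc-digits (suc N) (f (suc N)))
    where
    low : trunc x N ≡ trunc (digits (f (suc N))) N
    low = ≡-mod⇒≡ {{m^n≢0 2 N}} (trunc-< x N) (trunc-< _ N)
      (≡-mod-trans (trunc-x N) (≡-mod-trans (≡-mod-sym (compatible N)) (≡-mod-sym (trunc-digits N (f (suc N))))))

inverse-unique-mod : ∀ {q a x y} → a * x ≡ 1 [mod q ] → a * y ≡ 1 [mod q ] → x ≡ y [mod q ]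
inverse-unique-mod {q} {a} {x} {y} ax≡1 ay≡1 = begin
  x              ≡⟨ *-identityʳ x ⟨
  x * 1          ≈⟨ *-congˡ-mod x ay≡1 ⟨
  x * (a * y)    ≡⟨ regroup x a y ⟩
  (a * x) * y    ≈⟨ *-cong-mod ax≡1 ≡-mod-refl ⟩
  1 * y          ≡⟨ *-identityˡ y ⟩
  y              ∎
  where
  open ≡-mod-Reasoning q
  regroup : ∀ x a y → x * (a * y) ≡ a * x * y
  regroup x a y = solve (x ∷ a ∷ y ∷ [])

unit-from-residue : ∀ x {a} → trunc x 1 * a ≡ 1 [mod 2 ] → IsUnit₂ x
unit-from-residue x _ with x 0
... | true = refl
unit-from-residue x 0≡1 | false = ⊥-elim (odd⇒≢0-mod-2 (0 , refl) (≡-mod-sym 0≡1))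

unit-inverse : ∀ {s} → IsUnit₂ s → ∃ λ t → IsUnit₂ t × ∀ N → trunc t N * trunc s N ≡ 1 [mod 2 ^ N ]
unit-inverse {s} s₀≡1 = t , unit-from-residue t (ts≡1 1) , ts≡1
  where
  u⁻¹ : ℕ → ℕ
  u⁻¹ N = inverse-mod-2^ (unitTrunc s N) N
  inverse-of-trunc : ∀ {n N} → n ≤ suc N → n ≤ N → trunc s n * u⁻¹ N ≡ 1 [mod 2 ^ n ]
  inverse-of-trunc {n} {N} n≤1+N n≤N = ≡-mod-trans
    (*-cong-mod (≡-mod-sym (unitTrunc-≡-mod s₀≡1 n≤1+N)) ≡-mod-refl)
    (≡-mod-2^-≤ n≤N (odd-inverse (unitTrunc-odd s N) N))
  compatible : ∀ N → u⁻¹ (suc N) ≡ u⁻¹ N [mod 2 ^ N ]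
  compatible N = inverse-unique-mod {a = trunc s N}
    (inverse-of-trunc (≤-trans (n≤1+n N) (n≤1+n (suc N))) (n≤1+n N))
    (inverse-of-trunc (n≤1+n N) ≤-refl)
  t = proj₁ (fromResidues u⁻¹ compatible)
  ts≡1 : ∀ N → trunc t N * trunc s N ≡ 1 [mod 2 ^ N ]
  ts≡1 N = begin
    trunc t N * trunc s N  ≈⟨ *-cong-mod (proj₂ (fromResidues u⁻¹ compatible) N) ≡-mod-refl ⟩
    u⁻¹ N * trunc s N      ≡⟨ *-comm (u⁻¹ N) (trunc s N) ⟩
    trunc s N * u⁻¹ N      ≈⟨ inverse-of-trunc (n≤1+n N) ≤-refl ⟩
    1                      ∎
    where open ≡-mod-Reasoning (2 ^ N)

-- Vertices of level n as residues modulo 2ⁿ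

-- Binary numerals are read least significant digit first.
⟦_⟧ : Word → ℕ
⟦ [] ⟧    = 0
⟦ b ∷ w ⟧ = bit b + 2 * ⟦ w ⟧

⟦⟧-< : ∀ w → ⟦ w ⟧ < 2 ^ length w
⟦⟧-< [] = s≤s z≤n
⟦⟧-< (b ∷ w) = begin
  suc (bit b + 2 * ⟦ w ⟧)  ≤⟨ s≤s (+-monoˡ-≤ (2 * ⟦ w ⟧) (bit≤1 b)) ⟩
  2 + 2 * ⟦ w ⟧            ≡⟨ *-distribˡ-+ 2 1 ⟦ w ⟧ ⟨
  2 * suc ⟦ w ⟧            ≤⟨ *-monoʳ-≤ 2 (⟦⟧-< w) ⟩
  2 * 2 ^ length w         ∎
  where open ≤-Reasoning

⟦⟧-injective : ∀ v w → length v ≡ length w → ⟦ v ⟧ ≡ ⟦ w ⟧ → v ≡ w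
⟦⟧-injective [] [] _ _ = refl
⟦⟧-injective (true ∷ v) (true ∷ w) |v|≡|w| e =
  cong (true ∷_) (⟦⟧-injective v w (suc-injective |v|≡|w|) (*-cancelˡ-≡ _ _ 2 (suc-injective e)))
⟦⟧-injective (false ∷ v) (false ∷ w) |v|≡|w| e =
  cong (false ∷_) (⟦⟧-injective v w (suc-injective |v|≡|w|) (*-cancelˡ-≡ _ _ 2 e))
⟦⟧-injective (true ∷ v) (false ∷ w) _ e = ⊥-elim (1+2t≢2u ⟦ v ⟧ ⟦ w ⟧ e)
⟦⟧-injective (false ∷ v) (true ∷ w) _ e = ⊥-elim (1+2t≢2u ⟦ w ⟧ ⟦ v ⟧ (sym e))

⟦⟧-≡-mod-injective : ∀ {n} v w → length v ≡ n → length w ≡ n → ⟦ v ⟧ ≡ ⟦ w ⟧ [mod 2 ^ n ] → v ≡ w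
⟦⟧-≡-mod-injective {n} v w refl |w|≡n v≡w = ⟦⟧-injective v w (sym |w|≡n)
  (≡-mod⇒≡ {{m^n≢0 2 n}} (⟦⟧-< v) (subst (λ l → ⟦ w ⟧ < 2 ^ l) |w|≡n (⟦⟧-< w)) v≡w)

act-length : ∀ α v → length (act α v) ≡ length v
act-length α []      = refl
act-length α (x ∷ v) = cong suc (act-length (section α x) v)

act-∙ : ∀ α β v → act (α ∙ β) v ≡ act β (act α v)
act-∙ α β [] = refl
act-∙ α β (x ∷ v) = cong₂ _∷_ (sym (xor-assoc x (α []) (β [])))
  (act-∙ (section α x) (section β (x xor α [])) v)

act-idA : ∀ v → act idA v ≡ v
act-idA []      = refl
act-idA (x ∷ v) = cong₂ _∷_ (xor-identityʳ x) (act-idA v)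

act-local : ∀ α β v → (∀ w → length w < length v → α w ≡ β w) → act α v ≡ act β v
act-local α β [] _ = refl
act-local α β (x ∷ v) α≡β = cong₂ _∷_ (cong (x xor_) (α≡β [] (s≤s z≤n)))
  (act-local (section α x) (section β x) v (λ w |w|<|v| → α≡β (x ∷ w) (s≤s |w|<|v|)))

act-∷ʳ : ∀ α w x → act α (w ∷ʳ x) ≡ act α w ∷ʳ (x xor α w)
act-∷ʳ α []      x = refl
act-∷ʳ α (y ∷ w) x = cong ((y xor α []) ∷_) (act-∷ʳ (section α y) w x)

label-from-act : ∀ α β w → (∀ u → length u ≡ suc (length w) → act α u ≡ act β u) → α w ≡ β w
label-from-act α β w α≡β = proj₂ (∷ʳ-injective (act α w) (act β w) (begin
  act α w ∷ʳ (false xor α w)  ≡⟨ act-∷ʳ α w false ⟨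
  act α (w ∷ʳ false)          ≡⟨ α≡β (w ∷ʳ false) (trans (length-++ w) (+-comm (length w) 1)) ⟩
  act β (w ∷ʳ false)          ≡⟨ act-∷ʳ β w false ⟩
  act β w ∷ʳ (false xor β w)  ∎))
  where open ≡-Reasoning

∙-label-local : ∀ α β β′ w → (∀ u → length u ≡ length w → β u ≡ β′ u) → (α ∙ β) w ≡ (α ∙ β′) w
∙-label-local α β β′ [] β≡β′ = cong (α [] xor_) (β≡β′ [] refl)
∙-label-local α β β′ (x ∷ w) β≡β′ =
  ∙-label-local (section α x) (section β (x xor α [])) (section β′ (x xor α [])) w
    (λ u |u|≡|w| → β≡β′ (_ ∷ u) (cong suc |u|≡|w|))

-- γ^m and z_k as affine maps

act-γ : ∀ v → ⟦ act γ v ⟧ + 1 ≡ ⟦ v ⟧ [mod 2 ^ length v ]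
act-γ [] = ≡-mod-1 _ _
act-γ (false ∷ v) = begin
  1 + 2 * ⟦ act γ v ⟧ + 1  ≡⟨ carry ⟦ act γ v ⟧ ⟩
  2 * (⟦ act γ v ⟧ + 1)    ≈⟨ *-scale-mod 2 (act-γ v) ⟩
  2 * ⟦ v ⟧                ∎
  where
  open ≡-mod-Reasoning (2 ^ suc (length v))
  carry : ∀ y → 1 + 2 * y + 1 ≡ 2 * (y + 1)
  carry y = solve (y ∷ [])
act-γ (true ∷ v) = ≡-mod-reflexive (trans (+-comm _ 1) (cong (λ u → 1 + 2 * ⟦ u ⟧) (act-idA v)))

act-pow-γ : ∀ t v → ⟦ act (pow γ t) v ⟧ + t ≡ ⟦ v ⟧ [mod 2 ^ length v ]
act-pow-γ zero v = ≡-mod-reflexive (trans (+-identityʳ _) (cong ⟦_⟧ (act-idA v)))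
act-pow-γ (suc t) v = begin
  ⟦ act (pow γ t ∙ γ) v ⟧ + suc t  ≡⟨ cong (λ u → ⟦ u ⟧ + suc t) (act-∙ (pow γ t) γ v) ⟩
  ⟦ act γ u ⟧ + suc t              ≡⟨ +-assoc ⟦ act γ u ⟧ 1 t ⟨
  ⟦ act γ u ⟧ + 1 + t              ≈⟨ +-congʳ-mod t (≡-mod-2^-≡ (act-length _ v) (act-γ u)) ⟩
  ⟦ u ⟧ + t                        ≈⟨ act-pow-γ t v ⟩
  ⟦ v ⟧                            ∎
  where
  open ≡-mod-Reasoning (2 ^ length v)
  u = act (pow γ t) v

pow-γ-label : ∀ t t′ w → t ≡ t′ [mod 2 ^ suc (length w) ] → pow γ t w ≡ pow γ t′ w
pow-γ-label t t′ w t≡t′ = label-from-act (pow γ t) (pow γ t′) w same-action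
  where
  same-action : ∀ u → length u ≡ suc (length w) → act (pow γ t) u ≡ act (pow γ t′) u
  same-action u |u|≡1+|w| = ⟦⟧-≡-mod-injective _ _ (act-length _ u) (act-length _ u)
    (+-cancelʳ-mod t (begin
      ⟦ act (pow γ t) u ⟧ + t    ≈⟨ act-pow-γ t u ⟩
      ⟦ u ⟧                      ≈⟨ act-pow-γ t′ u ⟨
      ⟦ act (pow γ t′) u ⟧ + t′  ≈⟨ +-congˡ-mod _ (≡-mod-2^-≡ (sym |u|≡1+|w|) t≡t′) ⟨
      ⟦ act (pow γ t′) u ⟧ + t   ∎))
    where open ≡-mod-Reasoning (2 ^ length u)

n<2^n : ∀ n → n < 2 ^ n
n<2^n zero = s≤s z≤n
n<2^n (suc n) = begin-strict
  suc n          <⟨ s≤s (n<2^n n) ⟩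
  suc (2 ^ n)    ≤⟨ +-monoˡ-≤ (2 ^ n) (m^n>0 2 n) ⟩
  2 ^ n + 2 ^ n  ≡⟨ cong (2 ^ n +_) (+-identityʳ (2 ^ n)) ⟨
  2 ^ suc n      ∎
  where open ≤-Reasoning

-- γ ^₂ m is defined by truncating m at 2^(2^(|w|+1)) digits, far more than the label at w depends on.
γ^₂-label : ∀ m w {N} → suc (length w) ≤ N → (γ ^₂ m) w ≡ pow γ (trunc m N) w
γ^₂-label m w |w|<N = pow-γ-label _ _ w
  (≡-mod-trans (trunc-≡-mod m enough) (≡-mod-sym (trunc-≡-mod m |w|<N)))
  where
  enough : suc (length w) ≤ 2 ^ (2 ^ suc (length w))
  enough = <⇒≤ (<-trans (n<2^n _) (n<2^n _))

act-γ^₂ : ∀ m v {N} → length v ≤ N → ⟦ act (γ ^₂ m) v ⟧ + trunc m N ≡ ⟦ v ⟧ [mod 2 ^ length v ]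
act-γ^₂ m v {N} |v|≤N = ≡-mod-trans
  (≡-mod-reflexive (cong (λ u → ⟦ u ⟧ + trunc m N)
    (act-local _ _ v (λ w |w|<|v| → γ^₂-label m w (≤-trans |w|<|v| |v|≤N)))))
  (act-pow-γ (trunc m N) v)

zIter-stable : ∀ k {n n′} u → length u < n → length u < n′ → zIter k n u ≡ zIter k n′ u
zIter-stable k {suc n} {suc n′} [] _ _ = refl
zIter-stable k {suc n} {suc n′} (false ∷ u) (s≤s |u|<n) (s≤s |u|<n′) = zIter-stable k u |u|<n |u|<n′
zIter-stable k {suc n} {suc n′} (true ∷ u) (s≤s |u|<n) (s≤s |u|<n′) =
  ∙-label-local (γ ^₂ ell k) (zIter k n) (zIter k n′) u λ u′ |u′|≡|u| →
    zIter-stable k u′ (subst (_< n) (sym |u′|≡|u|) |u|<n) (subst (_< n′) (sym |u′|≡|u|) |u|<n′)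

z-true : ∀ k w → z k (true ∷ w) ≡ ((γ ^₂ ell k) ∙ z k) w
z-true k w = ∙-label-local (γ ^₂ ell k) _ _ w λ u |u|≡|w| →
  zIter-stable k u (≤-reflexive (cong suc |u|≡|w|)) ≤-refl

-- α acts on level n of T as the affine map x ↦ (x − M)/K of ℤ/2ⁿ.
record AffineOn (n K M : ℕ) (α : Aut) : Set where
  constructor affineOn
  field
    affine-≡ : ∀ v → length v ≡ n → M + K * ⟦ act α v ⟧ ≡ ⟦ v ⟧ [mod 2 ^ n ]

open AffineOn

z-affine : ∀ k {N} n → n ≤ N → AffineOn n (unitTrunc k N) 0 (z k)
z-affine k zero _ = affineOn λ _ _ → ≡-mod-1 _ _
z-affine k {N} (suc n) 1+n≤N = affineOn z-on-level
  where
  K = unitTrunc k N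
  L = trunc (ell k) N
  z-on-level : ∀ v → length v ≡ suc n → K * ⟦ act (z k) v ⟧ ≡ ⟦ v ⟧ [mod 2 ^ suc n ]
  z-on-level (false ∷ v) |v|≡1+n = begin
    K * (2 * ⟦ act (z k) v ⟧)  ≡⟨ *-comm-2 K ⟦ act (z k) v ⟧ ⟩
    2 * (K * ⟦ act (z k) v ⟧)  ≈⟨ *-scale-mod 2 (affine-≡ (z-affine k n (<⇒≤ 1+n≤N)) v (suc-injective |v|≡1+n)) ⟩
    2 * ⟦ v ⟧                  ∎
    where
    open ≡-mod-Reasoning (2 ^ suc n)
    *-comm-2 : ∀ x y → x * (2 * y) ≡ 2 * (x * y)
    *-comm-2 x y = solve (x ∷ y ∷ [])
  z-on-level (true ∷ v) |v|≡1+n = begin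
    K * ⟦ act (z k) (true ∷ v) ⟧     ≡⟨ cong (λ u → K * ⟦ u ⟧) z-on-v ⟩
    K * (1 + 2 * ⟦ act (z k) g ⟧)    ≡⟨ expand L ⟦ act (z k) g ⟧ ⟩
    1 + 2 * (L + K * ⟦ act (z k) g ⟧)
      ≈⟨ +-congˡ-mod 1 (*-scale-mod 2 (+-congˡ-mod L (affine-≡ (z-affine k n (<⇒≤ 1+n≤N)) g |g|≡n))) ⟩
    1 + 2 * (L + ⟦ g ⟧)              ≡⟨ cong (λ x → 1 + 2 * x) (+-comm L ⟦ g ⟧) ⟩
    1 + 2 * (⟦ g ⟧ + L)
      ≈⟨ +-congˡ-mod 1 (*-scale-mod 2 (≡-mod-2^-≡ |v|≡n (act-γ^₂ (ell k) v |v|≤N))) ⟩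
    1 + 2 * ⟦ v ⟧                    ∎
    where
    open ≡-mod-Reasoning (2 ^ suc n)
    g = act (γ ^₂ ell k) v
    |v|≡n : length v ≡ n
    |v|≡n = suc-injective |v|≡1+n
    |g|≡n : length g ≡ n
    |g|≡n = trans (act-length _ v) |v|≡n
    |v|≤N : length v ≤ N
    |v|≤N = subst (_≤ N) (sym |v|≡n) (<⇒≤ 1+n≤N)
    z-on-v : act (z k) (true ∷ v) ≡ true ∷ act (z k) g
    z-on-v = cong (true ∷_) (trans (act-local _ _ v (λ w _ → z-true k w)) (act-∙ (γ ^₂ ell k) (z k) v))
    expand : ∀ L y → (1 + 2 * L) * (1 + 2 * y) ≡ 1 + 2 * (L + (1 + 2 * L) * y)
    expand L y = solve (L ∷ y ∷ [])

γ^₂-affine : ∀ m {N} n → n ≤ N → AffineOn n 1 (trunc m N) (γ ^₂ m)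
γ^₂-affine m {N} n n≤N = affineOn λ where
  v refl → ≡-mod-trans
    (≡-mod-reflexive (trans (+-comm (trunc m N) _) (cong (_+ trunc m N) (*-identityˡ _))))
    (act-γ^₂ m v n≤N)

idA-affine : ∀ n → AffineOn n 1 0 idA
idA-affine n = affineOn λ v _ → ≡-mod-reflexive (trans (*-identityˡ _) (cong ⟦_⟧ (act-idA v)))

∙-affine : ∀ {n K K′ M M′ α β} → AffineOn n K M α → AffineOn n K′ M′ β →
           AffineOn n (K * K′) (M + K * M′) (α ∙ β)
∙-affine {n} {K} {K′} {M} {M′} {α} {β} α-affine β-affine = affineOn λ v |v|≡n →
  let w = act α v in begin
  M + K * M′ + K * K′ * ⟦ act (α ∙ β) v ⟧  ≡⟨ cong (λ u → M + K * M′ + K * K′ * ⟦ u ⟧) (act-∙ α β v) ⟩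
  M + K * M′ + K * K′ * ⟦ act β w ⟧        ≡⟨ regroup M K M′ K′ ⟦ act β w ⟧ ⟩
  M + K * (M′ + K′ * ⟦ act β w ⟧)
    ≈⟨ +-congˡ-mod M (*-congˡ-mod K (affine-≡ β-affine w (trans (act-length α v) |v|≡n))) ⟩
  M + K * ⟦ w ⟧                            ≈⟨ affine-≡ α-affine v |v|≡n ⟩
  ⟦ v ⟧                                    ∎
  where
  open ≡-mod-Reasoning (2 ^ n)
  regroup : ∀ M K M′ K′ y → M + K * M′ + K * K′ * y ≡ M + K * (M′ + K′ * y)
  regroup M K M′ K′ y = solve (M ∷ K ∷ M′ ∷ K′ ∷ y ∷ [])
pow-affine : ∀ {n K M α} → AffineOn n K M α → ∀ j → AffineOn n (K ^ j) (M * geometric K j) (pow α j)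
pow-affine {n} {K} {M} {α} _ zero =
  subst (λ M₀ → AffineOn n 1 M₀ idA) (sym (*-zeroʳ M)) (idA-affine n)
pow-affine {n} {K} {M} {α} α-affine (suc j) =
  subst₂ (λ K′ M′ → AffineOn n K′ M′ (pow α (suc j)))
    (*-comm (K ^ j) K) (regroup M (geometric K j) (K ^ j))
    (∙-affine (pow-affine α-affine j) α-affine)
  where
  regroup : ∀ M S P → M * S + P * M ≡ M * (S + P)
  regroup M S P = solve (M ∷ S ∷ P ∷ [])

γ^₂∙z-affine : ∀ m k {N} n → n ≤ N → AffineOn n (unitTrunc k N) (trunc m N) ((γ ^₂ m) ∙ z k)
γ^₂∙z-affine m k {N} n n≤N =
  subst₂ (λ K M → AffineOn n K M ((γ ^₂ m) ∙ z k)) (*-identityˡ _) (+-identityʳ _)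
    (∙-affine (γ^₂-affine m n n≤N) (z-affine k n n≤N))

-- Orbits and conjugacy of affine automorphisms

geometric-displacement : ∀ L M y j →
  M * geometric (1 + 2 * L) j + (1 + 2 * L) ^ j * y ≡ y + geometric (1 + 2 * L) j * (2 * L * y + M)
geometric-displacement L M y j = begin
  M * S + (1 + 2 * L) ^ j * y    ≡⟨ cong (λ P → M * S + P * y) (^≡1+*geometric (2 * L) j) ⟩
  M * S + (1 + 2 * L * S) * y    ≡⟨ regroup S ⟩
  y + S * (2 * L * y + M)        ∎
  where
  open ≡-Reasoning
  S = geometric (1 + 2 * L) j
  regroup : ∀ S → M * S + (1 + 2 * L * S) * y ≡ y + S * (2 * L * y + M)
  regroup S = solve (M ∷ S ∷ L ∷ y ∷ [])

affine-pow-displacement : ∀ {n L M α} → AffineOn n (1 + 2 * L) M α → ∀ j v → length v ≡ n →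
  ⟦ act (pow α j) v ⟧ + geometric (1 + 2 * L) j * (2 * L * ⟦ act (pow α j) v ⟧ + M) ≡ ⟦ v ⟧ [mod 2 ^ n ]
affine-pow-displacement {n} {L} {M} α-affine j v |v|≡n = ≡-mod-trans
  (≡-mod-reflexive (sym (geometric-displacement L M _ j)))
  (affine-≡ (pow-affine α-affine j) v |v|≡n)

2^a∣L⇒drift : ∀ {a L} → 2 ^ a ∣ L → ∀ y M′ → ∃ λ L′ → 2 * L * y + 2 ^ a * M′ ≡ 2 ^ a * (2 * (L′ * y) + M′)
2^a∣L⇒drift {a} (divides L′ refl) y M′ = L′ , factor L′ (2 ^ a)
  where
  factor : ∀ L′ P → 2 * (L′ * P) * y + P * M′ ≡ P * (2 * (L′ * y) + M′)
  factor L′ P = solve (L′ ∷ P ∷ y ∷ M′ ∷ [])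

2*-+-odd : ∀ x {o} → Odd o → Odd (2 * x + o)
2*-+-odd x (t , refl) = x + t , solve (x ∷ t ∷ [])

affine-pow-2^-returns : ∀ {a e L M′ α} → 2 ^ a ∣ L →
  AffineOn (a + e) (1 + 2 * L) (2 ^ a * M′) α → ∀ v → length v ≡ a + e → act (pow α (2 ^ e)) v ≡ v
affine-pow-2^-returns {a} {e} {L} {M′} {α} 2^a∣L α-affine v |v|≡a+e with 2^∣geometric-2^ L e
... | divides c S≡c2^e = ⟦⟧-≡-mod-injective _ v (trans (act-length _ v) |v|≡a+e) |v|≡a+e (begin
  ⟦ w ⟧                                        ≡⟨ +-identityʳ ⟦ w ⟧ ⟨
  ⟦ w ⟧ + 0                                    ≈⟨ +-congˡ-mod ⟦ w ⟧ (kq≡0-mod (c * O)) ⟨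
  ⟦ w ⟧ + c * O * 2 ^ (a + e)                  ≡⟨ cong (⟦ w ⟧ +_) regroup ⟩
  ⟦ w ⟧ + S * (2 * L * ⟦ w ⟧ + 2 ^ a * M′)     ≈⟨ affine-pow-displacement {L = L} α-affine (2 ^ e) v |v|≡a+e ⟩
  ⟦ v ⟧                                        ∎)
  where
  open ≡-mod-Reasoning (2 ^ (a + e))
  w = act (pow α (2 ^ e)) v
  S = geometric (1 + 2 * L) (2 ^ e)
  drift = 2^a∣L⇒drift {a} 2^a∣L ⟦ w ⟧ M′
  O = 2 * (proj₁ drift * ⟦ w ⟧) + M′
  reassoc : ∀ c Q P o → c * o * (P * Q) ≡ c * Q * (P * o)
  reassoc c Q P o = solve (c ∷ Q ∷ P ∷ o ∷ [])
  regroup : c * O * 2 ^ (a + e) ≡ S * (2 * L * ⟦ w ⟧ + 2 ^ a * M′)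
  regroup = trans (cong (c * O *_) (^-distribˡ-+-* 2 a e))
    (trans (reassoc c (2 ^ e) (2 ^ a) O) (sym (cong₂ _*_ S≡c2^e (proj₂ drift))))

affine-pow-returns⇒2^∣ : ∀ {a e L M′ α} → 2 ∣ L → 2 ^ a ∣ L → Odd M′ →
  AffineOn (a + e) (1 + 2 * L) (2 ^ a * M′) α → ∀ v → length v ≡ a + e →
  ∀ j → act (pow α j) v ≡ v → j ≡ 0 [mod 2 ^ e ]
affine-pow-returns⇒2^∣ {a} {e} {L} {M′} {α} 2∣L 2^a∣L M′-odd α-affine v |v|≡a+e j αʲv≡v =
  geometric≡0⇒≡0 {L} 2∣L e j (odd-*-cancelˡ-mod {n = e} (2*-+-odd (L′ * x) M′-odd)
    (≡-mod-trans (*-unscale-mod (2 ^ a) {{m^n≢0 2 a}} displacement≡0) (≡-mod-reflexive (sym (*-zeroʳ O)))))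
  where
  x = ⟦ v ⟧
  S = geometric (1 + 2 * L) j
  drift = 2^a∣L⇒drift {a} 2^a∣L x M′
  L′ = proj₁ drift
  O = 2 * (L′ * x) + M′
  reassoc : ∀ P o s → P * (o * s) ≡ s * (P * o)
  reassoc P o s = solve (P ∷ o ∷ s ∷ [])
  displacement≡0 : 2 ^ a * (O * S) ≡ 2 ^ a * 0 [mod 2 ^ a * 2 ^ e ]
  displacement≡0 = subst (λ q → 2 ^ a * (O * S) ≡ 2 ^ a * 0 [mod q ]) (^-distribˡ-+-* 2 a e)
    (+-cancelˡ-mod x (begin
    x + 2 ^ a * (O * S)               ≡⟨ cong (x +_) (reassoc (2 ^ a) O S) ⟩
    x + S * (2 ^ a * O)               ≡⟨ cong (λ d → x + S * d) (proj₂ drift) ⟨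
    x + S * (2 * L * x + 2 ^ a * M′)  ≡⟨ cong (λ w → ⟦ w ⟧ + S * (2 * L * ⟦ w ⟧ + 2 ^ a * M′)) αʲv≡v ⟨
    ⟦ αʲv ⟧ + S * (2 * L * ⟦ αʲv ⟧ + 2 ^ a * M′)
      ≈⟨ affine-pow-displacement {L = L} α-affine j v |v|≡a+e ⟩
    x                                 ≡⟨ +-identityʳ x ⟨
    x + 0                             ≡⟨ cong (x +_) (*-zeroʳ (2 ^ a)) ⟨
    x + 2 ^ a * 0                     ∎))
    where
    open ≡-mod-Reasoning (2 ^ (a + e))
    αʲv = act (pow α j) v

-- αʲ moves x by (1 + K + ⋯ + K^(j−1))(2Lx + M), and 2Lx + M is 2^a times an odd number, so x returns
-- exactly when 2^e divides the geometric sum, that is, when 2^e ∣ j.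
affine-cycleLength : ∀ {a e L M′ α} → 2 ∣ L → 2 ^ a ∣ L → Odd M′ →
  AffineOn (a + e) (1 + 2 * L) (2 ^ a * M′) α → ∀ v → length v ≡ a + e → CycleLength α v (2 ^ e)
affine-cycleLength {a} {e} 2∣L 2^a∣L M′-odd α-affine v |v|≡a+e =
    m^n>0 2 e
  , affine-pow-2^-returns {a} {e} 2^a∣L α-affine v |v|≡a+e
  , λ j 1≤j j<2^e αʲv≡v → <⇒≱ j<2^e
      (≡0-mod⇒≥ (affine-pow-returns⇒2^∣ {a} {e} 2∣L 2^a∣L M′-odd α-affine v |v|≡a+e j αʲv≡v) 1≤j)

affine-act-unique : ∀ {n K M M′ α β} → Odd K → M ≡ M′ [mod 2 ^ n ] →
  AffineOn n K M α → AffineOn n K M′ β → ∀ v → length v ≡ n → act α v ≡ act β v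
affine-act-unique {n} {K} {M} {M′} {α} {β} K-odd M≡M′ α-affine β-affine v |v|≡n =
  ⟦⟧-≡-mod-injective _ _ (trans (act-length α v) |v|≡n) (trans (act-length β v) |v|≡n)
    (odd-*-cancelˡ-mod {n = n} K-odd (+-cancelˡ-mod M (begin
      M + K * ⟦ act α v ⟧   ≈⟨ affine-≡ α-affine v |v|≡n ⟩
      ⟦ v ⟧                 ≈⟨ affine-≡ β-affine v |v|≡n ⟨
      M′ + K * ⟦ act β v ⟧  ≈⟨ +-congʳ-mod _ M≡M′ ⟨
      M + K * ⟦ act β v ⟧   ∎)))
  where open ≡-mod-Reasoning (2 ^ n)

affine-conjugate : ∀ {n K D M S α β δ} → Odd (D * K) → D * S ≡ M [mod 2 ^ n ] →
  AffineOn n K M α → AffineOn n K S β → AffineOn n D 0 δ →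
  ∀ v → length v ≡ n → act (α ∙ δ) v ≡ act (δ ∙ β) v
affine-conjugate {n} {K} {D} {M} {S} {α} {β} {δ} DK-odd DS≡M α-affine β-affine δ-affine =
  affine-act-unique DK-odd
    (≡-mod-trans (≡-mod-reflexive (trans (cong (M +_) (*-zeroʳ K)) (+-identityʳ M))) (≡-mod-sym DS≡M))
    (subst (λ K′ → AffineOn n K′ (M + K * 0) (α ∙ δ)) (*-comm K D) (∙-affine α-affine δ-affine))
    (∙-affine δ-affine β-affine)

γ^₂∙z-cycleLength : ∀ {m k a} → HasVal m a → ValAtLeast (ell k) a → ell k 0 ≡ false →
  ∀ e v → length v ≡ a + e → CycleLength ((γ ^₂ m) ∙ z k) v (2 ^ e)
γ^₂∙z-cycleLength {m} {k} {a} v₂m≡a 2^a∣ℓ ℓ₀≡0 e =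
  affine-cycleLength {a = a} {e = e} {L = trunc (ell k) N}
    (ValAtLeast⇒2^∣trunc 2∣ℓ 1≤N) (ValAtLeast⇒2^∣trunc 2^a∣ℓ a≤N)
    (unitTrunc-odd (shift a m) e)
    (subst (λ M → AffineOn (a + e) (unitTrunc k N) M ((γ ^₂ m) ∙ z k)) (trunc-HasVal v₂m≡a e)
      (γ^₂∙z-affine m k (a + e) (+-monoʳ-≤ a (n≤1+n e))))
  where
  N = a + suc e
  2∣ℓ : ValAtLeast (ell k) 1
  2∣ℓ zero _ = ℓ₀≡0
  2∣ℓ (suc _) (s≤s ())
  1≤N : 1 ≤ N
  1≤N = ≤-trans (s≤s z≤n) (m≤n+m (suc e) a)
  a≤N : a ≤ N
  a≤N = m≤m+n a (suc e)

γ^₂∙z-conjugate : ∀ {m s a} k → HasVal m a → HasVal s a → Conjugate ((γ ^₂ m) ∙ z k) ((γ ^₂ s) ∙ z k)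
γ^₂∙z-conjugate {m} {s} {a} k v₂m≡a v₂s≡a = z c ∙ z t , λ v → conjugate-at v (length v) refl
  where
  c = shift a m
  s′ = shift a s
  c-unit : IsUnit₂ c
  c-unit = HasVal⇒shift-unit {m} v₂m≡a
  s′-unit : IsUnit₂ s′
  s′-unit = HasVal⇒shift-unit {s} v₂s≡a
  s′⁻¹ = unit-inverse {s′} s′-unit
  t = proj₁ s′⁻¹
  conjugate-at : ∀ v n → length v ≡ n →
                 act ((γ ^₂ m) ∙ z k ∙ (z c ∙ z t)) v ≡ act ((z c ∙ z t) ∙ ((γ ^₂ s) ∙ z k)) v
  conjugate-at v n |v|≡n =
    affine-conjugate (odd-* (odd-* (unitTrunc-odd c N) (unitTrunc-odd t N)) (unitTrunc-odd k N)) CTS≡M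
      (γ^₂∙z-affine m k n n≤N) (γ^₂∙z-affine s k n n≤N)
      (subst (λ M → AffineOn n (C * T) M (z c ∙ z t)) (*-zeroʳ C) (∙-affine (z-affine c n n≤N) (z-affine t n n≤N)))
      v |v|≡n
    where
    N = a + suc n
    n≤N : n ≤ N
    n≤N = ≤-trans (n≤1+n n) (m≤n+m (suc n) a)
    C = unitTrunc c N
    T = unitTrunc t N
    CTS≡M : C * T * trunc s N ≡ trunc m N [mod 2 ^ n ]
    CTS≡M = begin
      C * T * trunc s N                       ≡⟨ cong (C * T *_) (trunc-HasVal {s} v₂s≡a n) ⟩
      C * T * (2 ^ a * unitTrunc s′ n)        ≡⟨ regroup (2 ^ a) C T (unitTrunc s′ n) ⟩
      2 ^ a * (C * (T * unitTrunc s′ n))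
        ≈⟨ *-congˡ-mod (2 ^ a) (*-cong-mod (≡-trunc c-unit) (*-cong-mod (≡-trunc (proj₁ (proj₂ s′⁻¹)))
                                             (unitTrunc-≡-mod s′-unit (n≤1+n n)))) ⟩
      2 ^ a * (trunc c n * (trunc t n * trunc s′ n))
        ≈⟨ *-congˡ-mod (2 ^ a) (*-congˡ-mod (trunc c n) (proj₂ (proj₂ s′⁻¹) n)) ⟩
      2 ^ a * (trunc c n * 1)                 ≡⟨ cong (2 ^ a *_) (*-identityʳ (trunc c n)) ⟩
      2 ^ a * trunc c n                       ≈⟨ *-congˡ-mod (2 ^ a) (unitTrunc-≡-mod c-unit (n≤1+n n)) ⟨
      2 ^ a * unitTrunc c n                   ≡⟨ trunc-HasVal {m} v₂m≡a n ⟨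
      trunc m N                               ∎
      where
      open ≡-mod-Reasoning (2 ^ n)
      ≡-trunc : ∀ {x} → IsUnit₂ x → unitTrunc x N ≡ trunc x n [mod 2 ^ n ]
      ≡-trunc x-unit = unitTrunc-≡-mod x-unit (≤-trans n≤N (n≤1+n N))
      regroup : ∀ P C T x → C * T * (P * x) ≡ P * (C * (T * x))
      regroup P C T x = solve (P ∷ C ∷ T ∷ x ∷ [])

2^-cycles⇒InStableCycle : ∀ {α a} → (∀ e v → length v ≡ a + e → CycleLength α v (2 ^ e)) →
  ∀ v → a ≤ length v → InStableCycle α v
2^-cycles⇒InStableCycle {α} {a} cycles v a≤|v| = 2 ^ d , cycles d v (sym (m+[n∸m]≡n a≤|v|)) , above
  where
  d = length v ∸ a
  above : ∀ u → 1 ≤ length u → CycleLength α (v ++ u) (2 ^ length u * 2 ^ d)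
  above u _ = subst (CycleLength α (v ++ u)) (^-distribˡ-+-* 2 (length u) d) (cycles (length u + d) (v ++ u) (begin
    length (v ++ u)          ≡⟨ length-++ v ⟩
    length v + length u      ≡⟨ cong (_+ length u) (m+[n∸m]≡n a≤|v|) ⟨
    a + d + length u         ≡⟨ +-assoc a d (length u) ⟩
    a + (d + length u)       ≡⟨ cong (a +_) (+-comm d (length u)) ⟩
    a + (length u + d)       ∎))
    where open ≡-Reasoning

proposition4p10 : ∀ (m s k : ℤ₂) →
    IsUnit₂ k → ¬ (k ≡₂ one₂) → ¬ (k ≡₂ minusOne₂) →
    ell k 0 ≡ false →
    ((a : ℕ) → HasVal m a → HasVal s a → ValAtLeast (ell k) a →
       Conjugate ((γ ^₂ m) ∙ z k) ((γ ^₂ s) ∙ z k))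
    ×
    ((a : ℕ) → HasVal m a → ValAtLeast (ell k) a →
       StronglySettled ((γ ^₂ m) ∙ z k)
       × (∀ (n : ℕ) → a ≤ n → ∀ v → length v ≡ n →
            InStableCycle ((γ ^₂ m) ∙ z k) v))
proposition4p10 m s k _ _ _ ℓ₀≡0 =
  (λ a v₂m≡a v₂s≡a _ → γ^₂∙z-conjugate {m} {s} {a} k v₂m≡a v₂s≡a) ,
  λ a v₂m≡a 2^a∣ℓ →
    let stable = 2^-cycles⇒InStableCycle (γ^₂∙z-cycleLength {m} {k} {a} v₂m≡a 2^a∣ℓ ℓ₀≡0) in
    (a , λ v |v|≡a → stable v (≤-reflexive (sym |v|≡a))) ,
    λ n a≤n v |v|≡n → stable v (subst (a ≤_) (sym |v|≡n) a≤n)
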